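{- Let $D$ be a connected digraph. Then: (i) $\langle D\rangle$ has a left zero if and only if all terminal components of $D$ are trivial; in this case, $\alpha\in\langle D\rangle$ is a left zero if and only if $v\alpha$ belongs to a terminal component for every vertex $v$. (ii) $\langle D\rangle$ has a right zero if and only if $D$ has exactly one terminal component; in this case, $\alpha\in\langle D\rangle$ is a right zero if and only if $\alpha$ is a constant map. (iii) $\langle D\rangle$ has a zero if and only if $D$ has exactly one terminal component $T$ and $T$ is trivial; in this case the zero of $\langle D\rangle$ is the constant map with image $T$.
   Context: For $a\neq b$ in $\{1,\ldots,n\}$, $(a\to b)$ denotes the transformation mapping $a$ to $b$ and fixing every other point; transformations act on the right and are composed left to right, $v(\alpha\beta)=(v\alpha)\beta$. For a digraph $D$ on $\{1,\ldots,n\}$ (no loops, no multiple arcs), $\langle D\rangle$ is the semigroup generated by all $(a\to b)$ with $(a,b)$ an arc. Connected means the underlying undirected graph is connected. A strong component is a maximal set of vertices any two of which are joined by directed paths in both directions (with its induced subdigraph); it is terminal if there is no arc from a vertex in it to a vertex outside it, and trivial if it has exactly one vertex. In a semigroup $S$, $a$ is a left zero if $ab=a$ for all $b\in S$, a right zero if $ba=a$ for all $b\in S$, and a zero if both. -}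

module Defs where

open import Data.Nat using (ℕ)
open import Data.Fin using (Fin; _≟_)
open import Data.Bool using (Bool; true; false; T)
open import Data.Product using (Σ; ∃; _×_; _,_)
open import Relation.Nullary using (yes; no)
open import Relation.Binary.PropositionalEquality using (_≡_)

-- A digraph on vertex set {1,…,n} (represented as Fin n): an adjacency
-- predicate with no loops.  Multiple arcs are impossible by construction.
record Digraph (n : ℕ) : Set where
  field
    adj    : Fin n → Fin n → Bool
    noLoop : ∀ v → adj v v ≡ false

module _ {n : ℕ} (D : Digraph n) where
  open Digraph D

  Arc : Fin n → Fin n → Set
  Arc a b = T (adj a b)

  data Reach : Fin n → Fin n → Set where
    here : ∀ {v} → Reach v v
    step : ∀ {u v w} → Arc u v → Reach v w → Reach u w

  data UPath : Fin n → Fin n → Set where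
    here : ∀ {v} → UPath v v
    fwd  : ∀ {u v w} → Arc u v → UPath v w → UPath u w
    bwd  : ∀ {u v w} → Arc v u → UPath v w → UPath u w

  Connected : Set
  Connected = ∀ u v → UPath u v

  SameComp : Fin n → Fin n → Set
  SameComp u v = Reach u v × Reach v u

  TerminalComp : Fin n → Set
  TerminalComp v = ∀ x y → SameComp v x → Arc x y → SameComp v y

  TrivialComp : Fin n → Set
  TrivialComp v = ∀ w → SameComp v w → w ≡ v

  AllTerminalTrivial : Set
  AllTerminalTrivial = ∀ v → TerminalComp v → TrivialComp v

  UniqueTerminalAt : Fin n → Set
  UniqueTerminalAt t = TerminalComp t × (∀ u → TerminalComp u → SameComp u t)

  ExactlyOneTerminal : Set
  ExactlyOneTerminal = ∃ λ t → UniqueTerminalAt t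

Transf : ℕ → Set
Transf n = Fin n → Fin n

elem : ∀ {n} → Fin n → Fin n → Transf n
elem a b v with v ≟ a
... | yes _ = b
... | no  _ = v

-- composition acting on the right, left to right: v (α ∙ β) = (v α) β
_∙_ : ∀ {n} → Transf n → Transf n → Transf n
(α ∙ β) v = β (α v)

module _ {n : ℕ} (D : Digraph n) where

  data Gen : Transf n → Set where
    gen  : ∀ {a b} → Arc D a b → Gen (elem a b)
    comp : ∀ {α β} → Gen α → Gen β → Gen (α ∙ β)

  -- membership in ⟨D⟩ (transformations compared pointwise)
  Mem : Transf n → Set
  Mem α = Σ (Transf n) λ γ → Gen γ × (∀ v → γ v ≡ α v)

  IsLeftZero : Transf n → Set
  IsLeftZero α = Mem α × (∀ β → Mem β → ∀ v → (α ∙ β) v ≡ α v)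

  IsRightZero : Transf n → Set
  IsRightZero α = Mem α × (∀ β → Mem β → ∀ v → (β ∙ α) v ≡ α v)

  IsZero : Transf n → Set
  IsZero α = IsLeftZero α × IsRightZero α

  HasLeftZero HasRightZero HasZero : Set
  HasLeftZero  = ∃ IsLeftZero
  HasRightZero = ∃ IsRightZero
  HasZero      = ∃ IsZero

Constant : ∀ {n} → Transf n → Set
Constant {n} α = ∃ λ (c : Fin n) → ∀ v → α v ≡ c

module Submission where

-- Everything rests on three observations about a generator (a → b):
--   * it moves a vertex only along an arc, so every α ∈ ⟨D⟩ satisfies v →* vα;
--   * it fixes every sink (vertex without out-arcs), hence so does all of ⟨D⟩;
--   * if vα has an out-arc (vα → y), the generator (vα → y) moves it.
-- A vertex is a sink iff its strong component is terminal and trivial.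
-- Hence left zeros are exactly the elements whose image consists of sinks,
-- and right zeros (constant on every arc, so constant by connectedness) are
-- exactly the constant elements; a constant element with image c forces c to
-- be reachable from everywhere, i.e. c lies in the unique terminal component.
--
-- For the existence halves we need two finiteness facts: every vertex reaches
-- a terminal component (found by descent on the finite set of reachable
-- vertices, which is computable by closing a subset under arcs), and the
-- "gathering" lemma: if each vertex can individually be pushed into an
-- absorbing set P by some element of ⟨D⟩¹ preserving P, then composing these
-- elements over all vertices yields α ∈ ⟨D⟩ with image inside P.
-- The three parts of the theorem are then short combinations of these facts.

open import Defs
open import Data.Nat using (ℕ; suc; _≤_; s≤s; z≤n)
open import Data.Fin using (Fin; _≟_) renaming (zero to fzero; suc to fsuc)
open import Data.Fin.Properties using (any?)
open import Data.Fin.Subset using (Subset; _∈_; _∉_; _⊂_; _∪_; ⁅_⁆)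
open import Data.Fin.Subset.Properties using (_∈?_; p⊆p∪q; x∈p∪q⁺; x∈p∪q⁻; x∈⁅x⁆; x∈⁅y⁆⇒x≡y)
open import Data.Fin.Subset.Induction using (⊃-wellFounded; ⊂-wellFounded)
open import Data.Bool using (T)
open import Data.Empty using (⊥-elim)
open import Data.Sum using (_⊎_; inj₁; inj₂)
open import Data.Product using (Σ; ∃; ∃₂; _×_; _,_; proj₁; proj₂)
open import Data.List using (List; []; _∷_; allFin)
open import Data.List.Relation.Unary.All as All using (All; []; _∷_)
open import Data.List.Membership.Propositional.Properties using (∈-allFin)
open import Function using (_on_)
open import Function.Bundles using (_⇔_; mk⇔)
open import Induction.WellFounded using (Acc; acc)
open import Relation.Binary.Construct.On as On using ()
open import Relation.Nullary using (¬_; Dec; yes; no)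
open import Relation.Nullary.Decidable using (T?; ¬?; _×-dec_; map′; decidable-stable)
open import Relation.Binary.PropositionalEquality using (_≡_; refl; sym; trans; cong; subst)

elem-source : ∀ {n} (a b : Fin n) → elem a b a ≡ b
elem-source a b with a ≟ a
... | yes _ = refl
... | no a≢a = ⊥-elim (a≢a refl)

elem-other : ∀ {n} {a b v : Fin n} → ¬ v ≡ a → elem a b v ≡ v
elem-other {a = a} {v = v} v≢a with v ≟ a
... | yes v≡a = ⊥-elim (v≢a v≡a)
... | no _ = refl

module Reachability {n : ℕ} (D : Digraph n) where

  reach-trans : ∀ {u v w} → Reach D u v → Reach D v w → Reach D u w
  reach-trans here q = q
  reach-trans (step a p) q = step a (reach-trans p q)

  record ReachClosure (u : Fin n) : Set where
    field
      set        : Subset n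
      has-source : u ∈ set
      closed     : ∀ {a b} → a ∈ set → Arc D a b → b ∈ set
      sound      : ∀ {v} → v ∈ set → Reach D u v

  Exit : Subset n → Set
  Exit S = ∃₂ λ a b → a ∈ S × Arc D a b × b ∉ S

  exit? : ∀ S → Dec (Exit S)
  exit? S = any? λ a → any? λ b → (a ∈? S) ×-dec T? (Digraph.adj D a b) ×-dec ¬? (b ∈? S)

  -- Grow S along leaving arcs until it is closed; terminates since S strictly
  -- increases inside the finite lattice of subsets.
  close : ∀ {u} S → Acc (λ p q → q ⊂ p) S → u ∈ S → (∀ {v} → v ∈ S → Reach D u v) → ReachClosure u
  close S (acc grow) u∈S sound with exit? S
  ... | no noExit = record
    { set = S ; has-source = u∈S ; sound = sound
    ; closed = λ {a} {b} a∈S ab → decidable-stable (b ∈? S) (λ b∉S → noExit (a , b , a∈S , ab , b∉S)) }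
  ... | yes (a , b , a∈S , ab , b∉S) =
    close (S ∪ ⁅ b ⁆) (grow (p⊆p∪q ⁅ b ⁆ , b , x∈p∪q⁺ (inj₂ (x∈⁅x⁆ b)) , b∉S))
          (p⊆p∪q ⁅ b ⁆ u∈S) sound′
    where
      sound′ : ∀ {v} → v ∈ S ∪ ⁅ b ⁆ → Reach D _ v
      sound′ v∈ with x∈p∪q⁻ S ⁅ b ⁆ v∈
      ... | inj₁ v∈S = sound v∈S
      ... | inj₂ v∈b rewrite x∈⁅y⁆⇒x≡y b v∈b = reach-trans (sound a∈S) (step ab here)

  reachClosure : ∀ u → ReachClosure u
  reachClosure u = close ⁅ u ⁆ (⊃-wellFounded ⁅ u ⁆) (x∈⁅x⁆ u) sound
    where
      sound : ∀ {v} → v ∈ ⁅ u ⁆ → Reach D u v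
      sound v∈u rewrite x∈⁅y⁆⇒x≡y u v∈u = here

  reachable : Fin n → Subset n
  reachable u = ReachClosure.set (reachClosure u)

  reachable-complete : ∀ {u v} → Reach D u v → v ∈ reachable u
  reachable-complete {u} = go (ReachClosure.has-source (reachClosure u))
    where
      go : ∀ {x v} → x ∈ reachable u → Reach D x v → v ∈ reachable u
      go x∈ here = x∈
      go x∈ (step xy p) = go (ReachClosure.closed (reachClosure u) x∈ xy) p

  reach? : ∀ u v → Dec (Reach D u v)
  reach? u v = map′ (ReachClosure.sound (reachClosure u)) reachable-complete (v ∈? reachable u)

  reachable-shrinks : ∀ {u y} → Reach D u y → ¬ Reach D y u → reachable y ⊂ reachable u
  reachable-shrinks {u} {y} uy ¬yu =
      (λ v∈ → reachable-complete (reach-trans uy (ReachClosure.sound (reachClosure y) v∈)))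
    , u , reachable-complete here , λ u∈ → ¬yu (ReachClosure.sound (reachClosure y) u∈)

  -- Every vertex reaches a terminal component: if u's component is not
  -- terminal, some y reachable from u does not return, and we descend to y.
  reachesTerminal : ∀ u → ∃ λ t → Reach D u t × TerminalComp D t
  reachesTerminal u = descend u (On.wellFounded reachable ⊂-wellFounded u)
    where
      descend : ∀ u → Acc (_⊂_ on reachable) u → ∃ λ t → Reach D u t × TerminalComp D t
      descend u (acc smaller) with any? (λ y → reach? u y ×-dec ¬? (reach? y u))
      ... | yes (y , uy , ¬yu) =
        let (t , yt , terminal) = descend y (smaller (reachable-shrinks uy ¬yu))
        in t , reach-trans uy yt , terminal
      ... | no noEscape = u , here , λ x y (ux , _) xy →
        let uy = reach-trans ux (step xy here)
        in uy , decidable-stable (reach? y u) (λ ¬yu → noEscape (y , uy , ¬yu))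

module Sinks {n : ℕ} (D : Digraph n) where

  Sink : Fin n → Set
  Sink s = ∀ y → ¬ Arc D s y

  sink-reach : ∀ {s w} → Sink s → Reach D s w → w ≡ s
  sink-reach sink here = refl
  sink-reach sink (step a _) = ⊥-elim (sink _ a)

  sink⇒terminal : ∀ {s} → Sink s → TerminalComp D s
  sink⇒terminal sink x y (sx , _) xy with sink-reach sink sx
  ... | refl = ⊥-elim (sink y xy)

  sink⇒trivial : ∀ {s} → Sink s → TrivialComp D s
  sink⇒trivial sink w (sw , _) = sink-reach sink sw

  -- A terminal trivial component is a sink: an out-arc would stay in the
  -- component, so it would be a loop.
  terminalTrivial⇒sink : ∀ {s} → TerminalComp D s → TrivialComp D s → Sink s
  terminalTrivial⇒sink {s} terminal trivial y sy with trivial y (terminal s y (here , here) sy)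
  ... | refl = subst T (Digraph.noLoop D s) sy

  terminal-closed : ∀ {t x y} → TerminalComp D t → SameComp D t x → Reach D x y → SameComp D t y
  terminal-closed terminal tx here = tx
  terminal-closed {x = x} terminal tx (step xv p) = terminal-closed terminal (terminal x _ tx xv) p

module Elements {n : ℕ} (D : Digraph n) where
  open Reachability D
  open Sinks D

  mem-arc : ∀ {a b} → Arc D a b → Mem D (elem a b)
  mem-arc ab = elem _ _ , gen ab , λ _ → refl

  mem-cong : ∀ {α β} → Mem D α → (∀ v → α v ≡ β v) → Mem D β
  mem-cong (γ , g , γ≗α) α≗β = γ , g , λ v → trans (γ≗α v) (α≗β v)

  gen-reach : ∀ {γ} → Gen D γ → ∀ v → Reach D v (γ v)
  gen-reach (gen {a} ab) v with v ≟ a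
  ... | yes refl = step ab here
  ... | no _ = here
  gen-reach (comp {α} g h) v = reach-trans (gen-reach g v) (gen-reach h (α v))

  mem-reach : ∀ {α} → Mem D α → ∀ v → Reach D v (α v)
  mem-reach (γ , g , γ≗α) v = subst (Reach D v) (γ≗α v) (gen-reach g v)

  gen-sink : ∀ {γ s} → Gen D γ → Sink s → γ s ≡ s
  gen-sink {s = s} (gen {a} {b} ab) sink with s ≟ a
  ... | yes refl = ⊥-elim (sink b ab)
  ... | no _ = refl
  gen-sink (comp {α} {β} g h) sink = trans (cong β (gen-sink g sink)) (gen-sink h sink)

  mem-sink : ∀ {α s} → Mem D α → Sink s → α s ≡ s
  mem-sink (γ , g , γ≗α) sink = trans (sym (γ≗α _)) (gen-sink g sink)

  -- ⟨D⟩¹: the monoid obtained by adjoining the identity to ⟨D⟩.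
  Mem¹ : Transf n → Set
  Mem¹ β = (∀ v → β v ≡ v) ⊎ Mem D β

  mem-comp¹ : ∀ {α β} → Mem D α → Mem¹ β → Mem D (α ∙ β)
  mem-comp¹ mα (inj₁ β≗id) = mem-cong mα λ v → sym (β≗id _)
  mem-comp¹ {α} (γ , g , γ≗α) (inj₂ (δ , h , δ≗β)) =
    γ ∙ δ , comp g h , λ v → trans (cong δ (γ≗α v)) (δ≗β (α v))

  mem¹-sink : ∀ {β s} → Mem¹ β → Sink s → β s ≡ s
  mem¹-sink (inj₁ β≗id) _ = β≗id _
  mem¹-sink (inj₂ mβ) sink = mem-sink mβ sink

  pushAlong : ∀ {u t} → Reach D u t → Σ (Transf n) λ β → Mem¹ β × β u ≡ t × β t ≡ t
  pushAlong here = (λ x → x) , inj₁ (λ _ → refl) , refl , refl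
  pushAlong {u} {t} (step {v = v} uv vt) with u ≟ t
  ... | yes u≡t = (λ x → x) , inj₁ (λ _ → refl) , u≡t , refl
  ... | no u≢t =
    let (β , mβ , βv , βt) = pushAlong vt
    in elem u v ∙ β , inj₂ (mem-comp¹ (mem-arc uv) mβ)
     , trans (cong β (elem-source u v)) βv
     , trans (cong β (elem-other (λ t≡u → u≢t (sym t≡u)))) βt

  gather : ∀ {α₀} (P : Fin n → Set) → Mem D α₀ →
           (∀ u → Σ (Transf n) λ β → Mem¹ β × P (β u) × (∀ x → P x → P (β x))) →
           Σ (Transf n) λ α → Mem D α × (∀ v → P (α v))
  gather {α₀} P mα₀ push =
    let (α , mα , inP) = gatherList (allFin n) in α , mα , λ v → All.lookup inP (∈-allFin v)
    where
      gatherList : (vs : List (Fin n)) → Σ (Transf n) λ α → Mem D α × All (λ w → P (α w)) vs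
      gatherList [] = α₀ , mα₀ , []
      gatherList (v ∷ vs) =
        let (α , mα , inP) = gatherList vs
            (β , mβ , βv , preserves) = push (α v)
        in α ∙ β , mem-comp¹ mα mβ , βv ∷ All.map (λ {w} → preserves (α w)) inP

module LeftZeros {n : ℕ} (D : Digraph n) where
  open Reachability D
  open Sinks D
  open Elements D

  -- The image of a left zero consists of sinks: an arc (vα → y) would give a
  -- generator moving vα.
  leftZero⇒sinkImage : ∀ {α} → IsLeftZero D α → ∀ v → Sink (α v)
  leftZero⇒sinkImage {α} (_ , leftZero) v y αv→y =
    subst T (Digraph.noLoop D (α v)) (subst (Arc D (α v)) moved αv→y)
    where
      moved : y ≡ α v
      moved = trans (sym (elem-source (α v) y)) (leftZero (elem (α v) y) (mem-arc αv→y) v)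

  sinkImage⇒leftZero : ∀ {α} → Mem D α → (∀ v → Sink (α v)) → IsLeftZero D α
  sinkImage⇒leftZero mα sinks = mα , λ β mβ v → mem-sink mβ (sinks v)

  -- A left zero sends a terminal vertex v into its own component, onto a sink,
  -- so v itself is a sink.
  leftZero⇒allTerminalTrivial : HasLeftZero D → AllTerminalTrivial D
  leftZero⇒allTerminalTrivial (α , lz) v terminal = sink⇒trivial (subst Sink (sym v≡αv) (sinks v))
    where
      sinks = leftZero⇒sinkImage lz
      v≡αv : v ≡ α v
      v≡αv = sink-reach (sinks v) (proj₂ (terminal-closed terminal (here , here) (mem-reach (proj₁ lz) v)))

  -- Conversely every vertex reaches a terminal, hence sink, vertex; gathering
  -- into the sinks produces a left zero.
  allTerminalTrivial⇒leftZero : ∀ {α₀} → Mem D α₀ → AllTerminalTrivial D → HasLeftZero D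
  allTerminalTrivial⇒leftZero mα₀ allTrivial =
    let (α , mα , sinks) = gather Sink mα₀ pushToSink in α , sinkImage⇒leftZero mα sinks
    where
      pushToSink : ∀ u → Σ (Transf n) λ β → Mem¹ β × Sink (β u) × (∀ x → Sink x → Sink (β x))
      pushToSink u =
        let (s , us , terminal) = reachesTerminal u
            (β , mβ , βu , _) = pushAlong us
        in β , mβ , subst Sink (sym βu) (terminalTrivial⇒sink terminal (allTrivial s terminal))
         , λ x sink → subst Sink (sym (mem¹-sink mβ sink)) sink

  leftZero⇔terminalImage : AllTerminalTrivial D → ∀ α → Mem D α →
                           IsLeftZero D α ⇔ (∀ v → TerminalComp D (α v))
  leftZero⇔terminalImage allTrivial α mα = mk⇔
    (λ lz v → sink⇒terminal (leftZero⇒sinkImage lz v))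
    (λ terminal → sinkImage⇒leftZero mα λ v → terminalTrivial⇒sink (terminal v) (allTrivial _ (terminal v)))

module RightZeros {n : ℕ} (D : Digraph n) where
  open Reachability D
  open Sinks D
  open Elements D

  rightZero-arc : ∀ {α} → IsRightZero D α → ∀ {a b} → Arc D a b → α b ≡ α a
  rightZero-arc {α} (_ , rz) {a} {b} ab = trans (cong α (sym (elem-source a b))) (rz (elem a b) (mem-arc ab) a)

  rightZero-path : ∀ {α} → IsRightZero D α → ∀ {u v} → UPath D u v → α u ≡ α v
  rightZero-path rz here = refl
  rightZero-path rz (fwd ab p) = trans (sym (rightZero-arc rz ab)) (rightZero-path rz p)
  rightZero-path rz (bwd ba p) = trans (rightZero-arc rz ba) (rightZero-path rz p)

  rightZero⇒constant : Connected D → Fin n → ∀ {α} → IsRightZero D α → Constant α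
  rightZero⇒constant connected v₀ {α} rz = α v₀ , λ v → rightZero-path rz (connected v v₀)

  constant⇒rightZero : ∀ {α} → Mem D α → Constant α → IsRightZero D α
  constant⇒rightZero mα (c , α≡c) = mα , λ β _ v → trans (α≡c _) (sym (α≡c v))

  -- If an element of ⟨D⟩ is constant with value c, every vertex reaches c, so
  -- c's component is terminal and every terminal component contains c.
  constantMem⇒uniqueTerminal : ∀ {α c} → Mem D α → (∀ v → α v ≡ c) → UniqueTerminalAt D c
  constantMem⇒uniqueTerminal {α} {c} mα α≡c =
    (λ x y (cx , _) xy → reach-trans cx (step xy here) , reachesC y) ,
    λ u terminal → terminal-closed terminal (here , here) (reachesC u)
    where
      reachesC : ∀ v → Reach D v c
      reachesC v = subst (Reach D v) (α≡c v) (mem-reach mα v)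

  -- Conversely, if t lies in the unique terminal component, every vertex
  -- reaches t, and gathering into {t} yields the constant map with value t.
  uniqueTerminal⇒constantMem : ∀ {α₀ t} → Mem D α₀ → UniqueTerminalAt D t →
                               Σ (Transf n) λ α → Mem D α × (∀ v → α v ≡ t)
  uniqueTerminal⇒constantMem {t = t} mα₀ (_ , unique) = gather (λ x → x ≡ t) mα₀ pushToT
    where
      pushToT : ∀ u → Σ (Transf n) λ β → Mem¹ β × β u ≡ t × (∀ x → x ≡ t → β x ≡ t)
      pushToT u =
        let (s , us , terminal) = reachesTerminal u
            (β , mβ , βu , βt) = pushAlong (reach-trans us (proj₁ (unique s terminal)))
        in β , mβ , βu , λ { x refl → βt }

module Zeros {n : ℕ} (D : Digraph n) where
  open Sinks D
  open LeftZeros D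
  open RightZeros D

  zero⇒constantSink : Connected D → Fin n → ∀ {α} → IsZero D α → ∃ λ c → (∀ v → α v ≡ c) × Sink c
  zero⇒constantSink connected v₀ (lz , rz) =
    let (c , α≡c) = rightZero⇒constant connected v₀ rz
    in c , α≡c , subst Sink (α≡c v₀) (leftZero⇒sinkImage lz v₀)

  constantSink⇒zero : ∀ {α t} → Mem D α → (∀ v → α v ≡ t) → Sink t → IsZero D α
  constantSink⇒zero mα α≡t sink =
    sinkImage⇒leftZero mα (λ v → subst Sink (sym (α≡t v)) sink) , constant⇒rightZero mα (_ , α≡t)

  sink-in-uniqueTerminal : ∀ {c t} → Sink c → UniqueTerminalAt D t → t ≡ c
  sink-in-uniqueTerminal sink (_ , unique) = sink-reach sink (proj₁ (unique _ (sink⇒terminal sink)))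

-- A connected digraph on at least two vertices has an arc, so ⟨D⟩ is nonempty.
connected⇒mem : ∀ {n} → 2 ≤ n → (D : Digraph n) → Connected D → ∃ (Mem D)
connected⇒mem (s≤s (s≤s z≤n)) D connected with connected fzero (fsuc fzero)
... | fwd ab _ = _ , Elements.mem-arc D ab
... | bwd ba _ = _ , Elements.mem-arc D ba

proposition6p3 : (n : ℕ) → 2 ≤ n → (D : Digraph n) → Connected D →
    ((HasLeftZero D ⇔ AllTerminalTrivial D)
      × (AllTerminalTrivial D → ∀ α → Mem D α →
           (IsLeftZero D α ⇔ (∀ v → TerminalComp D (α v)))))
  × ((HasRightZero D ⇔ ExactlyOneTerminal D)
      × (ExactlyOneTerminal D → ∀ α → Mem D α →
           (IsRightZero D α ⇔ Constant α)))
  × ((HasZero D ⇔ (∃ λ t → UniqueTerminalAt D t × TrivialComp D t))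
      × (∀ t → UniqueTerminalAt D t → TrivialComp D t →
           ∀ α → (IsZero D α ⇔ (∀ v → α v ≡ t))))
proposition6p3 (suc _) 2≤n D connected =
    ( mk⇔ leftZero⇒allTerminalTrivial (allTerminalTrivial⇒leftZero mα₀) , leftZero⇔terminalImage )
  , ( mk⇔ hasRightZero⇒one one⇒hasRightZero
    , λ _ α mα → mk⇔ (rightZero⇒constant connected v₀) (constant⇒rightZero mα) )
  , ( mk⇔ hasZero⇒terminalSink terminalSink⇒hasZero , zero⇔constantAt )
  where
    open Sinks D
    open LeftZeros D
    open RightZeros D
    open Zeros D
    v₀ = fzero
    mα₀ = proj₂ (connected⇒mem 2≤n D connected)

    hasRightZero⇒one : HasRightZero D → ExactlyOneTerminal D
    hasRightZero⇒one (α , rz) =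
      let (c , α≡c) = rightZero⇒constant connected v₀ rz in c , constantMem⇒uniqueTerminal (proj₁ rz) α≡c

    one⇒hasRightZero : ExactlyOneTerminal D → HasRightZero D
    one⇒hasRightZero (t , unique) =
      let (α , mα , α≡t) = uniqueTerminal⇒constantMem mα₀ unique in α , constant⇒rightZero mα (t , α≡t)

    hasZero⇒terminalSink : HasZero D → ∃ λ t → UniqueTerminalAt D t × TrivialComp D t
    hasZero⇒terminalSink (α , z) =
      let (c , α≡c , sink) = zero⇒constantSink connected v₀ z
      in c , constantMem⇒uniqueTerminal (proj₁ (proj₁ z)) α≡c , sink⇒trivial sink

    terminalSink⇒hasZero : (∃ λ t → UniqueTerminalAt D t × TrivialComp D t) → HasZero D
    terminalSink⇒hasZero (t , unique , trivial) =
      let (α , mα , α≡t) = uniqueTerminal⇒constantMem mα₀ unique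
      in α , constantSink⇒zero mα α≡t (terminalTrivial⇒sink (proj₁ unique) trivial)

    zero⇔constantAt : ∀ t → UniqueTerminalAt D t → TrivialComp D t → ∀ α → IsZero D α ⇔ (∀ v → α v ≡ t)
    zero⇔constantAt t unique trivial α = mk⇔
      (λ z → let (c , α≡c , sink) = zero⇒constantSink connected v₀ z
             in λ v → trans (α≡c v) (sym (sink-in-uniqueTerminal sink unique)))
      (λ α≡t → let (κ , mκ , κ≡t) = uniqueTerminal⇒constantMem mα₀ unique
               in constantSink⇒zero (Elements.mem-cong D mκ λ v → trans (κ≡t v) (sym (α≡t v))) α≡t
                    (terminalTrivial⇒sink (proj₁ unique) trivial))
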